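{- Let $k\ge1$ and let $\lambda=(\lambda_1,\ldots,\lambda_k)$ be a composition of $n$, and $\lambda'=(\lambda_2,\ldots,\lambda_k)$ (a composition of $n-\lambda_1$, empty if $k=1$). The number of $\lambda$-unimodal involutions $\pi\in\mathcal{S}_n$ with $\pi_1>\pi_2>\cdots>\pi_{\lambda_1}$ and $\pi_1\le\lambda_1$ equals the number of $\lambda'$-unimodal involutions in $\mathcal{S}_{n-\lambda_1}$ (which is $1$ when $\lambda'$ is empty). Consequently \[D^k_1(\boldsymbol{x})=\frac{x_1}{1-x_1}L^{k-1}(\boldsymbol{x};\hat x_1).\]
   Context: $\mathcal{S}_n$ is the set of permutations of $[n]$, in one-line notation $\pi=\pi_1\cdots\pi_n$. A sequence is unimodal if it is strictly increasing and then strictly decreasing. For a composition $\lambda=(\lambda_1,\ldots,\lambda_k)$ of $n$, $\pi\in\mathcal{S}_n$ is $\lambda$-unimodal if cutting its one-line notation into consecutive segments of lengths $\lambda_1,\ldots,\lambda_k$ gives unimodal segments. An involution is a permutation equal to its own inverse; $\mathcal{I}^\lambda$ is the set of $\lambda$-unimodal involutions. $\mathcal{D}^\lambda_1$ is the set of $\pi\in\mathcal{I}^\lambda$ with $\pi_1\le\lambda_1$ and $\pi_1>\cdots>\pi_{\lambda_1}$. $\Lambda_m$ is the set of compositions with exactly $m$ parts; $\boldsymbol{x}=(x_1,\ldots,x_k)$ are indeterminates, $x^\lambda=\prod x_i^{\lambda_i}$. $L^m(x_1,\ldots,x_m)=\sum_{\lambda\in\Lambda_m}|\mathcal{I}^\lambda|x^\lambda$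 with $L^0=1$, and $D^k_1(\boldsymbol{x})=\sum_{\lambda\in\Lambda_k}|\mathcal{D}^\lambda_1|x^\lambda$. $L^{k-1}(\boldsymbol{x};\hat x_1)$ means $L^{k-1}(x_2,\ldots,x_k)$. -}

module Defs where

open import Data.Nat using (ℕ; zero; suc; _+_; _<ᵇ_)
open import Data.Bool using (Bool; true; false; _∧_; if_then_else_)
open import Data.Fin using (Fin; toℕ)
open import Data.List using (List; []; _∷_; take; drop; map; concatMap; allFin; length; filterᵇ)
open import Data.Nat.ListAction using (sum)
open import Data.Bool.ListAction using (all)
open import Data.Vec using (Vec; []; _∷_; lookup; toList)

-- One-line notation: a permutation of [n] is a vector π : Vec (Fin n) n,
-- with value j (0-based) standing for j+1 and position i (0-based) for i+1.

decreasingᵇ : List ℕ → Bool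
decreasingᵇ [] = true
decreasingᵇ (x ∷ []) = true
decreasingᵇ (x ∷ y ∷ r) = (y <ᵇ x) ∧ decreasingᵇ (y ∷ r)

unimodalᵇ : List ℕ → Bool
unimodalᵇ [] = true
unimodalᵇ (x ∷ []) = true
unimodalᵇ (x ∷ y ∷ r) = if x <ᵇ y then unimodalᵇ (y ∷ r) else decreasingᵇ (x ∷ y ∷ r)

segments : List ℕ → List ℕ → List (List ℕ)
segments [] xs = []
segments (l ∷ ls) xs = take l xs ∷ segments ls (drop l xs)

oneLine : ∀ {n} → Vec (Fin n) n → List ℕ
oneLine π = map toℕ (toList π)

λUnimodalᵇ : ∀ {n} → List ℕ → Vec (Fin n) n → Bool
λUnimodalᵇ λ' π = all unimodalᵇ (segments λ' (oneLine π))

_==ᶠ_ : ∀ {n} → Fin n → Fin n → Bool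
a ==ᶠ b = eqℕ (toℕ a) (toℕ b)
  where
  eqℕ : ℕ → ℕ → Bool
  eqℕ zero zero = true
  eqℕ zero (suc _) = false
  eqℕ (suc _) zero = false
  eqℕ (suc m) (suc k) = eqℕ m k

-- Involution: π (π i) = i for all i (this also forces π to be a bijection).
involutionᵇ : ∀ {n} → Vec (Fin n) n → Bool
involutionᵇ {n} π = all (λ i → lookup π (lookup π i) ==ᶠ i) (allFin n)

allVecs : (n m : ℕ) → List (Vec (Fin n) m)
allVecs n zero = [] ∷ []
allVecs n (suc m) = concatMap (λ a → map (a ∷_) (allVecs n m)) (allFin n)

inIᵇ : (λ' : List ℕ) → Vec (Fin (sum λ')) (sum λ') → Bool
inIᵇ λ' π = involutionᵇ π ∧ λUnimodalᵇ λ' π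

countI : List ℕ → ℕ
countI λ' = length (filterᵇ (inIᵇ λ') (allVecs (sum λ') (sum λ')))

-- Membership in D^λ_1 for λ = (λ₁ ∷ λ'): π ∈ I^λ, π_1 ≤ λ₁ and
-- π_1 > π_2 > ... > π_{λ₁}.  (With 0-based values, π_1 ≤ λ₁ is toℕ π₀ < λ₁.)
inD1ᵇ : (λ₁ : ℕ) (λ' : List ℕ) → Vec (Fin (sum (λ₁ ∷ λ'))) (sum (λ₁ ∷ λ')) → Bool
inD1ᵇ λ₁ λ' π = inIᵇ (λ₁ ∷ λ') π ∧ firstOK (oneLine π) ∧ decreasingᵇ (take λ₁ (oneLine π))
  where
  firstOK : List ℕ → Bool
  firstOK [] = false
  firstOK (x ∷ _) = x <ᵇ λ₁

countD1 : ℕ → List ℕ → ℕ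
countD1 λ₁ λ' = length (filterᵇ (inD1ᵇ λ₁ λ') (allVecs (sum (λ₁ ∷ λ')) (sum (λ₁ ∷ λ'))))

-- A strictly decreasing first segment of length λ₁ whose first value is at most λ₁ can only be
-- λ₁, λ₁−1, …, 1. This block is an involution of {1,…,λ₁} on its own, so an involution π extending it
-- takes no value ≤ λ₁ in later positions; hence π is the block followed by a λ'-unimodal involution of
-- {λ₁+1,…,n}, i.e. a λ'-unimodal involution of [n−λ₁] shifted by λ₁, and shifting preserves unimodality.
-- Counting over all vectors, one therefore fixes the first block and then restricts the remaining
-- entries to values above λ₁.
module Submission where

open import Data.Bool using (Bool; true; false; _∧_; T)
open import Data.Bool.ListAction using (all)
open import Data.Bool.Properties using (¬-not; T-≡; ∧-identityʳ; ⇔→≡)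
open import Data.Fin using (Fin; zero; suc; toℕ; _↑ˡ_; _↑ʳ_; punchIn; opposite; splitAt)
open import Data.Fin.Properties
  using ( punchInᵢ≢i; toℕ-injective; toℕ<n; toℕ-↑ˡ; toℕ-↑ʳ; ↑ˡ-injective; ↑ʳ-injective
        ; splitAt⁻¹-↑ˡ; splitAt⁻¹-↑ʳ; opposite-prop; opposite-involutive)
open import Data.List
  using (List; []; _∷_; _++_; length; filterᵇ; map; concatMap; tabulate; take; drop; downFrom; allFin)
import Data.List.Properties as LP
open import Data.List.Relation.Unary.All using (All)
import Data.List.Relation.Unary.All.Properties as All
open import Data.List.Relation.Unary.All.Properties using (all⁺; all⁻)
open import Data.Nat using (ℕ; zero; suc; _+_; _∸_; _<_; _≤_; _<ᵇ_; z≤n; s≤s⁻¹)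
open import Data.Nat.ListAction using (sum)
open import Data.Nat.Properties
  using (+-0-commutativeMonoid; +-identityʳ; +-assoc; <ᵇ⇒<; ≤-<-trans; ≤-antisym; m+n≮m; module ≤-Reasoning)
open import Data.Product using (_×_; _,_; proj₁; proj₂)
open import Data.Sum using (inj₁; inj₂)
open import Data.Vec using (Vec; []; _∷_; lookup)
import Data.Vec as Vec
import Data.Vec.Properties as Vec
open import Defs
open import Function using (_∘_; id; Equivalence; _⇔_; mk⇔)
import Function.Properties.Equivalence as ⇔
open import Relation.Binary.PropositionalEquality

open import Algebra.Properties.CommutativeMonoid.Sum +-0-commutativeMonoid
  using (sum-syntax; sum-cong-≗; sum-replicate-zero; sum-remove)

private
  variable
    A B : Set
    n m k b : ℕ

count : (A → Bool) → List A → ℕ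
count p xs = length (filterᵇ p xs)

count-++ : ∀ (p : A → Bool) xs ys → count p (xs ++ ys) ≡ count p xs + count p ys
count-++ p []       ys = refl
count-++ p (x ∷ xs) ys with p x
... | true  = cong suc (count-++ p xs ys)
... | false = count-++ p xs ys

count-map : ∀ (p : B → Bool) (f : A → B) xs → count p (map f xs) ≡ count (p ∘ f) xs
count-map p f []       = refl
count-map p f (x ∷ xs) with p (f x)
... | true  = cong suc (count-map p f xs)
... | false = count-map p f xs

count-cong : ∀ {p q : A → Bool} → (∀ x → p x ≡ q x) → ∀ xs → count p xs ≡ count q xs
count-cong p≗q []       = refl
count-cong {p = p} {q} p≗q (x ∷ xs) rewrite p≗q x with q x
... | true  = cong suc (count-cong p≗q xs)
... | false = count-cong p≗q xs

count-none : ∀ {p : A → Bool} → (∀ x → p x ≡ false) → ∀ xs → count p xs ≡ 0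
count-none p≡false []       = refl
count-none p≡false (x ∷ xs) rewrite p≡false x = count-none p≡false xs

count-concatMap-tabulate : ∀ (p : B → Bool) (g : A → List B) (f : Fin n → A) →
  count p (concatMap g (tabulate f)) ≡ ∑[ i < n ] count p (g (f i))
count-concatMap-tabulate {n = zero}  p g f = refl
count-concatMap-tabulate {n = suc n} p g f =
  trans (count-++ p (g (f zero)) _) (cong (count p (g (f zero)) +_) (count-concatMap-tabulate p g (f ∘ suc)))

∑-zero : ∀ n (f : Fin n → ℕ) → (∀ i → f i ≡ 0) → ∑[ i < n ] f i ≡ 0
∑-zero n f f≡0 = trans (sum-cong-≗ f≡0) (sum-replicate-zero n)

∑-single : ∀ (i : Fin n) (f : Fin n → ℕ) → (∀ j → j ≢ i → f j ≡ 0) → ∑[ j < n ] f j ≡ f i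
∑-single {suc n} i f f≡0 = begin
  ∑[ j < suc n ] f j               ≡⟨ sum-remove f ⟩
  f i + ∑[ j < n ] f (punchIn i j) ≡⟨ cong (f i +_) (∑-zero n _ (λ j → f≡0 _ (punchInᵢ≢i i j))) ⟩
  f i + 0                          ≡⟨ +-identityʳ (f i) ⟩
  f i                              ∎
  where open ≡-Reasoning

∑-↑ : ∀ k b (f : Fin (k + b) → ℕ) →
  ∑[ i < k + b ] f i ≡ ∑[ y < k ] f (y ↑ˡ b) + ∑[ z < b ] f (k ↑ʳ z)
∑-↑ zero    b f = refl
∑-↑ (suc k) b f = trans (cong (f zero +_) (∑-↑ k b (f ∘ suc))) (sym (+-assoc (f zero) _ _))

count-allVecs-suc : ∀ n m (P : Vec (Fin n) (suc m) → Bool) →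
  count P (allVecs n (suc m)) ≡ ∑[ a < n ] count (P ∘ (a ∷_)) (allVecs n m)
count-allVecs-suc n m P =
  trans (count-concatMap-tabulate {n = n} P _ id) (sum-cong-≗ (λ a → count-map P (a ∷_) (allVecs n m)))

count-allVecs-++ : ∀ k m (u₀ : Vec (Fin n) k) (P : Vec (Fin n) (k + m) → Bool) →
  (∀ u s → P (u Vec.++ s) ≡ true → u ≡ u₀) →
  count P (allVecs n (k + m)) ≡ count (P ∘ (u₀ Vec.++_)) (allVecs n m)
count-allVecs-++          zero    m []        P only-u₀ = refl
count-allVecs-++ {n = n} (suc k) m (a₀ ∷ u₀) P only-u₀ = begin
  count P (allVecs n (suc k + m))               ≡⟨ count-allVecs-suc n (k + m) P ⟩
  ∑[ a < n ] count-with-head a                  ≡⟨ ∑-single a₀ count-with-head other-heads-vanish ⟩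
  count-with-head a₀                            ≡⟨ count-allVecs-++ k m u₀ _ only-u₀-tail ⟩
  count (P ∘ ((a₀ ∷ u₀) Vec.++_)) (allVecs n m) ∎
  where
  open ≡-Reasoning
  count-with-head : Fin n → ℕ
  count-with-head a = count (P ∘ (a ∷_)) (allVecs n (k + m))
  other-heads-vanish : ∀ a → a ≢ a₀ → count-with-head a ≡ 0
  other-heads-vanish a a≢a₀ = count-none P-false (allVecs n (k + m))
    where
    P-false : ∀ v → P (a ∷ v) ≡ false
    P-false v with Vec.splitAt k v
    ... | u , s , refl = ¬-not (a≢a₀ ∘ Vec.∷-injectiveˡ ∘ only-u₀ (a ∷ u) s)
  only-u₀-tail : ∀ u s → P (a₀ ∷ u Vec.++ s) ≡ true → u ≡ u₀
  only-u₀-tail u s = Vec.∷-injectiveʳ ∘ only-u₀ (a₀ ∷ u) s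

count-allVecs-↑ʳ : ∀ k b m (P : Vec (Fin (k + b)) m → Bool) →
  (∀ v i y → lookup v i ≡ y ↑ˡ b → P v ≡ false) →
  count P (allVecs (k + b) m) ≡ count (P ∘ Vec.map (k ↑ʳ_)) (allVecs b m)
count-allVecs-↑ʳ k b zero    P low⇒false with P []
... | true  = refl
... | false = refl
count-allVecs-↑ʳ k b (suc m) P low⇒false = begin
  count P (allVecs (k + b) (suc m))
    ≡⟨ count-allVecs-suc (k + b) m P ⟩
  ∑[ a < k + b ] count-with-head a
    ≡⟨ ∑-↑ k b count-with-head ⟩
  ∑[ y < k ] count-with-head (y ↑ˡ b) + ∑[ z < b ] count-with-head (k ↑ʳ z)
    ≡⟨ cong₂ _+_ (∑-zero k _ low-heads-vanish) (sum-cong-≗ high-heads) ⟩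
  ∑[ z < b ] count (P ∘ Vec.map (k ↑ʳ_) ∘ (z ∷_)) (allVecs b m)
    ≡⟨ count-allVecs-suc b m _ ⟨
  count (P ∘ Vec.map (k ↑ʳ_)) (allVecs b (suc m))
    ∎
  where
  open ≡-Reasoning
  count-with-head : Fin (k + b) → ℕ
  count-with-head a = count (P ∘ (a ∷_)) (allVecs (k + b) m)
  low-heads-vanish : ∀ y → count-with-head (y ↑ˡ b) ≡ 0
  low-heads-vanish y = count-none (λ v → low⇒false ((y ↑ˡ b) ∷ v) zero y refl) (allVecs (k + b) m)
  high-heads : ∀ z → count-with-head (k ↑ʳ z) ≡ count (P ∘ Vec.map (k ↑ʳ_) ∘ (z ∷_)) (allVecs b m)
  high-heads z = count-allVecs-↑ʳ k b m (P ∘ ((k ↑ʳ z) ∷_)) (λ v i → low⇒false _ (suc i))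

n<ᵇ1+n : ∀ n → (n <ᵇ suc n) ≡ true
n<ᵇ1+n zero    = refl
n<ᵇ1+n (suc n) = n<ᵇ1+n n

1+n<ᵇn : ∀ n → (suc n <ᵇ n) ≡ false
1+n<ᵇn zero    = refl
1+n<ᵇn (suc n) = 1+n<ᵇn n

+-cancelˡ-<ᵇ : ∀ c x y → (c + x <ᵇ c + y) ≡ (x <ᵇ y)
+-cancelˡ-<ᵇ zero    x y = refl
+-cancelˡ-<ᵇ (suc c) x y = +-cancelˡ-<ᵇ c x y

<ᵇ≡true⇒< : ∀ {x y} → (x <ᵇ y) ≡ true → x < y
<ᵇ≡true⇒< {x} {y} x<ᵇy = <ᵇ⇒< x y (Equivalence.from T-≡ x<ᵇy)

∧≡true⇒ : ∀ {x y} → x ∧ y ≡ true → x ≡ true × y ≡ true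
∧≡true⇒ {true} y≡true = refl , y≡true

decreasingᵇ-map-+ : ∀ c xs → decreasingᵇ (map (c +_) xs) ≡ decreasingᵇ xs
decreasingᵇ-map-+ c []           = refl
decreasingᵇ-map-+ c (x ∷ [])     = refl
decreasingᵇ-map-+ c (x ∷ y ∷ xs) = cong₂ _∧_ (+-cancelˡ-<ᵇ c y x) (decreasingᵇ-map-+ c (y ∷ xs))

unimodalᵇ-map-+ : ∀ c xs → unimodalᵇ (map (c +_) xs) ≡ unimodalᵇ xs
unimodalᵇ-map-+ c []           = refl
unimodalᵇ-map-+ c (x ∷ [])     = refl
unimodalᵇ-map-+ c (x ∷ y ∷ xs) with ih ← unimodalᵇ-map-+ c (y ∷ xs)
  rewrite +-cancelˡ-<ᵇ c x y with x <ᵇ y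
... | true  = ih
... | false = decreasingᵇ-map-+ c (x ∷ y ∷ xs)

all-unimodalᵇ-segments-map-+ : ∀ c ls xs →
  all unimodalᵇ (segments ls (map (c +_) xs)) ≡ all unimodalᵇ (segments ls xs)
all-unimodalᵇ-segments-map-+ c []       xs = refl
all-unimodalᵇ-segments-map-+ c (l ∷ ls) xs
  rewrite LP.take-map {f = c +_} l xs | LP.drop-map {f = c +_} l xs =
  cong₂ _∧_ (unimodalᵇ-map-+ c (take l xs)) (all-unimodalᵇ-segments-map-+ c ls (drop l xs))

decreasingᵇ-downFrom : ∀ n → decreasingᵇ (downFrom n) ≡ true
decreasingᵇ-downFrom zero          = refl
decreasingᵇ-downFrom (suc zero)    = refl
decreasingᵇ-downFrom (suc (suc n)) =
  trans (cong (_∧ decreasingᵇ (downFrom (suc n))) (n<ᵇ1+n n)) (decreasingᵇ-downFrom (suc n))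

unimodalᵇ-downFrom : ∀ n → unimodalᵇ (downFrom n) ≡ true
unimodalᵇ-downFrom zero          = refl
unimodalᵇ-downFrom (suc zero)    = refl
unimodalᵇ-downFrom (suc (suc n)) rewrite 1+n<ᵇn n = decreasingᵇ-downFrom (suc (suc n))

decreasingᵇ⇒length≤head : ∀ x xs → decreasingᵇ (x ∷ xs) ≡ true → length xs ≤ x
decreasingᵇ⇒length≤head x []       _   = z≤n
decreasingᵇ⇒length≤head x (y ∷ xs) dec with y <ᵇ x in y<ᵇx
... | true = ≤-<-trans (decreasingᵇ⇒length≤head y xs dec) (<ᵇ≡true⇒< y<ᵇx)

decreasingᵇ⇒≡downFrom : ∀ x xs → decreasingᵇ (x ∷ xs) ≡ true → x < suc (length xs) →
  x ∷ xs ≡ downFrom (suc (length xs))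
decreasingᵇ⇒≡downFrom x xs dec x<1+len with ≤-antisym (s≤s⁻¹ x<1+len) (decreasingᵇ⇒length≤head x xs dec)
decreasingᵇ⇒≡downFrom x []       dec _ | refl = refl
decreasingᵇ⇒≡downFrom x (y ∷ xs) dec _ | refl with y <ᵇ x in y<ᵇx
... | true = cong (x ∷_) (decreasingᵇ⇒≡downFrom y xs dec (<ᵇ≡true⇒< y<ᵇx))

entries : Vec (Fin n) k → List ℕ
entries v = map toℕ (Vec.toList v)

length-entries : ∀ (v : Vec (Fin n) k) → length (entries v) ≡ k
length-entries []      = refl
length-entries (x ∷ v) = cong suc (length-entries v)

entries-injective : ∀ (u v : Vec (Fin n) k) → entries u ≡ entries v → u ≡ v
entries-injective []      []      _  = refl
entries-injective (x ∷ u) (y ∷ v) eq =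
  cong₂ _∷_ (toℕ-injective (LP.∷-injectiveˡ eq)) (entries-injective u v (LP.∷-injectiveʳ eq))

take-entries-++ : ∀ (u : Vec (Fin n) k) (s : Vec (Fin n) m) → take k (entries (u Vec.++ s)) ≡ entries u
take-entries-++ []      s = refl
take-entries-++ (x ∷ u) s = cong (toℕ x ∷_) (take-entries-++ u s)

drop-entries-++ : ∀ (u : Vec (Fin n) k) (s : Vec (Fin n) m) → drop k (entries (u Vec.++ s)) ≡ entries s
drop-entries-++ []      s = refl
drop-entries-++ (x ∷ u) s = drop-entries-++ u s

entries-map-↑ˡ : ∀ b (v : Vec (Fin n) k) → entries (Vec.map (_↑ˡ b) v) ≡ entries v
entries-map-↑ˡ b []      = refl
entries-map-↑ˡ b (x ∷ v) = cong₂ _∷_ (toℕ-↑ˡ x b) (entries-map-↑ˡ b v)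

entries-map-↑ʳ : ∀ c (v : Vec (Fin n) k) → entries (Vec.map (c ↑ʳ_) v) ≡ map (c +_) (entries v)
entries-map-↑ʳ c []      = refl
entries-map-↑ʳ c (x ∷ v) = cong₂ _∷_ (toℕ-↑ʳ c x) (entries-map-↑ʳ c v)

entries-tabulate-downFrom : ∀ k (f : Fin k → Fin n) → (∀ i → toℕ (f i) ≡ k ∸ suc (toℕ i)) →
  entries (Vec.tabulate f) ≡ downFrom k
entries-tabulate-downFrom zero    f _  = refl
entries-tabulate-downFrom (suc k) f eq = cong₂ _∷_ (eq zero) (entries-tabulate-downFrom k (f ∘ suc) (eq ∘ suc))

IsInvolution : Vec (Fin n) n → Set
IsInvolution π = ∀ i → lookup π (lookup π i) ≡ i

==ᶠ⇒≡ : ∀ (a b : Fin n) → T (a ==ᶠ b) → a ≡ b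
==ᶠ⇒≡ zero    zero    _ = refl
==ᶠ⇒≡ (suc a) (suc b) t = cong suc (==ᶠ⇒≡ a b t)

==ᶠ-refl : ∀ (a : Fin n) → T (a ==ᶠ a)
==ᶠ-refl zero    = _
==ᶠ-refl (suc a) = ==ᶠ-refl a

involutionᵇ-reflects : ∀ (π : Vec (Fin n) n) → involutionᵇ π ≡ true ⇔ IsInvolution π
involutionᵇ-reflects {n} π = mk⇔
  (λ inv i → ==ᶠ⇒≡ _ _ (All.tabulate⁻ (all⁺ _ (allFin n) (Equivalence.from T-≡ inv)) i))
  (λ inv → Equivalence.to T-≡ (all⁻ _ (All.tabulate⁺ λ i →
     subst (λ j → T (lookup π (lookup π i) ==ᶠ j)) (inv i) (==ᶠ-refl (lookup π (lookup π i))))))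

descending : Vec (Fin n) n
descending = Vec.tabulate opposite

entries-descending : entries (descending {n}) ≡ downFrom n
entries-descending {n} = entries-tabulate-downFrom n opposite opposite-prop

descending-involution : IsInvolution (descending {n})
descending-involution i = begin
  lookup descending (lookup descending i) ≡⟨ cong (lookup descending) (Vec.lookup∘tabulate opposite i) ⟩
  lookup descending (opposite i)          ≡⟨ Vec.lookup∘tabulate opposite (opposite i) ⟩
  opposite (opposite i)                   ≡⟨ opposite-involutive i ⟩
  i                                       ∎
  where open ≡-Reasoning

↑-elim : ∀ {P : Fin (k + b) → Set} → (∀ y → P (y ↑ˡ b)) → (∀ z → P (k ↑ʳ z)) → ∀ x → P x
↑-elim {k} {P = P} left right x with splitAt k x in eq
... | inj₁ y = subst P (splitAt⁻¹-↑ˡ eq) (left y)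
... | inj₂ z = subst P (splitAt⁻¹-↑ʳ eq) (right z)

↑ˡ≢↑ʳ : ∀ (y : Fin k) (z : Fin b) → y ↑ˡ b ≢ k ↑ʳ z
↑ˡ≢↑ʳ {k} {b} y z eq = m+n≮m k (toℕ z) (begin-strict
  k + toℕ z      ≡⟨ toℕ-↑ʳ k z ⟨
  toℕ (k ↑ʳ z)   ≡⟨ cong toℕ eq ⟨
  toℕ (y ↑ˡ b)   ≡⟨ toℕ-↑ˡ y b ⟩
  toℕ y          <⟨ toℕ<n y ⟩
  k              ∎)
  where open ≤-Reasoning

_⊕_ : Vec (Fin k) k → Vec (Fin b) b → Vec (Fin (k + b)) (k + b)
_⊕_ {k} {b} ρ σ = Vec.map (_↑ˡ b) ρ Vec.++ Vec.map (k ↑ʳ_) σ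

module _ (ρ : Vec (Fin k) k) (σ : Vec (Fin b) b) where

  lookup-⊕-↑ˡ : ∀ y → lookup (ρ ⊕ σ) (y ↑ˡ b) ≡ lookup ρ y ↑ˡ b
  lookup-⊕-↑ˡ y = trans (Vec.lookup-++ˡ (Vec.map (_↑ˡ b) ρ) (Vec.map (k ↑ʳ_) σ) y) (Vec.lookup-map y (_↑ˡ b) ρ)

  lookup-⊕-↑ʳ : ∀ z → lookup (ρ ⊕ σ) (k ↑ʳ z) ≡ k ↑ʳ lookup σ z
  lookup-⊕-↑ʳ z = trans (Vec.lookup-++ʳ (Vec.map (_↑ˡ b) ρ) (Vec.map (k ↑ʳ_) σ) z) (Vec.lookup-map z (k ↑ʳ_) σ)

  ⊕-involution : IsInvolution ρ → IsInvolution σ → IsInvolution (ρ ⊕ σ)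
  ⊕-involution ρ-inv σ-inv = ↑-elim
    (λ y → begin
      lookup (ρ ⊕ σ) (lookup (ρ ⊕ σ) (y ↑ˡ b)) ≡⟨ cong (lookup (ρ ⊕ σ)) (lookup-⊕-↑ˡ y) ⟩
      lookup (ρ ⊕ σ) (lookup ρ y ↑ˡ b)         ≡⟨ lookup-⊕-↑ˡ (lookup ρ y) ⟩
      lookup ρ (lookup ρ y) ↑ˡ b               ≡⟨ cong (_↑ˡ b) (ρ-inv y) ⟩
      y ↑ˡ b                                   ∎)
    (λ z → begin
      lookup (ρ ⊕ σ) (lookup (ρ ⊕ σ) (k ↑ʳ z)) ≡⟨ cong (lookup (ρ ⊕ σ)) (lookup-⊕-↑ʳ z) ⟩
      lookup (ρ ⊕ σ) (k ↑ʳ lookup σ z)         ≡⟨ lookup-⊕-↑ʳ (lookup σ z) ⟩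
      k ↑ʳ lookup σ (lookup σ z)               ≡⟨ cong (k ↑ʳ_) (σ-inv z) ⟩
      k ↑ʳ z                                   ∎)
    where open ≡-Reasoning

  ⊕-involution⁻ : IsInvolution (ρ ⊕ σ) → IsInvolution ρ × IsInvolution σ
  ⊕-involution⁻ inv = ρ-inv , σ-inv
    where
    open ≡-Reasoning
    ρ-inv : IsInvolution ρ
    ρ-inv y = ↑ˡ-injective b _ _ (begin
      lookup ρ (lookup ρ y) ↑ˡ b               ≡⟨ lookup-⊕-↑ˡ (lookup ρ y) ⟨
      lookup (ρ ⊕ σ) (lookup ρ y ↑ˡ b)         ≡⟨ cong (lookup (ρ ⊕ σ)) (lookup-⊕-↑ˡ y) ⟨
      lookup (ρ ⊕ σ) (lookup (ρ ⊕ σ) (y ↑ˡ b)) ≡⟨ inv (y ↑ˡ b) ⟩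
      y ↑ˡ b                                   ∎)
    σ-inv : IsInvolution σ
    σ-inv z = ↑ʳ-injective k _ _ (begin
      k ↑ʳ lookup σ (lookup σ z)               ≡⟨ lookup-⊕-↑ʳ (lookup σ z) ⟨
      lookup (ρ ⊕ σ) (k ↑ʳ lookup σ z)         ≡⟨ cong (lookup (ρ ⊕ σ)) (lookup-⊕-↑ʳ z) ⟨
      lookup (ρ ⊕ σ) (lookup (ρ ⊕ σ) (k ↑ʳ z)) ≡⟨ inv (k ↑ʳ z) ⟩
      k ↑ʳ z                                   ∎)

module FirstBlockDescending (j : ℕ) (λ' : List ℕ) where

  M : ℕ
  M = sum λ'

  D1 : Vec (Fin (suc j + M)) (suc j + M) → Bool
  D1 = inD1ᵇ (suc j) λ'

  block : Vec (Fin (suc j + M)) (suc j)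
  block = Vec.map (_↑ˡ M) descending

  entries-block : entries block ≡ downFrom (suc j)
  entries-block = trans (entries-map-↑ˡ M descending) entries-descending

  lookup-block : ∀ (v : Vec (Fin (suc j + M)) M) y → lookup (block Vec.++ v) (y ↑ˡ M) ≡ opposite y ↑ˡ M
  lookup-block v y = begin
    lookup (block Vec.++ v) (y ↑ˡ M) ≡⟨ Vec.lookup-++ˡ block v y ⟩
    lookup block y                   ≡⟨ Vec.lookup-map y (_↑ˡ M) descending ⟩
    lookup descending y ↑ˡ M         ≡⟨ cong (_↑ˡ M) (Vec.lookup∘tabulate opposite y) ⟩
    opposite y ↑ˡ M                  ∎
    where open ≡-Reasoning

  block-forced : ∀ u s → D1 (u Vec.++ s) ≡ true → u ≡ block
  block-forced (x ∷ u) s d1 = entries-injective _ _ (begin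
    toℕ x ∷ entries u                   ≡⟨ decreasingᵇ⇒≡downFrom (toℕ x) (entries u) dec x<1+len ⟩
    downFrom (suc (length (entries u))) ≡⟨ cong (downFrom ∘ suc) (length-entries u) ⟩
    downFrom (suc j)                    ≡⟨ entries-block ⟨
    entries block                       ∎)
    where
    open ≡-Reasoning
    first-and-dec : (toℕ x <ᵇ suc j) ∧ decreasingᵇ (take (suc j) (entries ((x ∷ u) Vec.++ s))) ≡ true
    first-and-dec = proj₂ (∧≡true⇒ {x = inIᵇ (suc j ∷ λ') ((x ∷ u) Vec.++ s)} d1)
    dec : decreasingᵇ (toℕ x ∷ entries u) ≡ true
    dec = subst (λ xs → decreasingᵇ xs ≡ true) (take-entries-++ (x ∷ u) s) (proj₂ (∧≡true⇒ first-and-dec))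
    x<1+len : toℕ x < suc (length (entries u))
    x<1+len = subst (λ l → toℕ x < suc l) (sym (length-entries u)) (<ᵇ≡true⇒< (proj₁ (∧≡true⇒ first-and-dec)))

  tail-avoids-block : ∀ v i y → lookup v i ≡ y ↑ˡ M → D1 (block Vec.++ v) ≡ false
  tail-avoids-block v i y vᵢ≡y = ¬-not λ d1 → ↑ˡ≢↑ʳ (opposite y) i (begin
    opposite y ↑ˡ M                  ≡⟨ lookup-block v y ⟨
    lookup π (y ↑ˡ M)                ≡⟨ cong (lookup π) (trans (Vec.lookup-++ʳ block v i) vᵢ≡y) ⟨
    lookup π (lookup π (suc j ↑ʳ i)) ≡⟨ Equivalence.to (involutionᵇ-reflects π) (proj₁ (∧≡true⇒ (proj₁ (∧≡true⇒ d1)))) (suc j ↑ʳ i) ⟩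
    suc j ↑ʳ i                       ∎)
    where
    open ≡-Reasoning
    π = block Vec.++ v

  D1-descending-⊕ : ∀ σ → D1 (descending ⊕ σ) ≡ inIᵇ λ' σ
  -- The conjuncts of inD1ᵇ are, in order: involution, first segment unimodal, later segments
  -- unimodal, π₁ ≤ λ₁, first segment decreasing.
  D1-descending-⊕ σ =
    trans (cong₂ _∧_ (cong₂ _∧_ involution-equiv (cong₂ _∧_ block-unimodal tail-unimodal-equiv))
                     (cong₂ _∧_ first≤λ₁ block-decreasing))
          (∧-identityʳ _)
    where
    π = descending ⊕ σ
    block-entries : take (suc j) (entries π) ≡ downFrom (suc j)
    block-entries = trans (take-entries-++ block _) entries-block
    block-unimodal : unimodalᵇ (take (suc j) (entries π)) ≡ true
    block-unimodal = trans (cong unimodalᵇ block-entries) (unimodalᵇ-downFrom (suc j))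
    block-decreasing : decreasingᵇ (take (suc j) (entries π)) ≡ true
    block-decreasing = trans (cong decreasingᵇ block-entries) (decreasingᵇ-downFrom (suc j))
    first≤λ₁ : (toℕ (lookup π zero) <ᵇ suc j) ≡ true
    first≤λ₁ = trans (cong (_<ᵇ suc j) (LP.∷-injectiveˡ entries-block)) (n<ᵇ1+n j)
    tail-unimodal-equiv : all unimodalᵇ (segments λ' (drop (suc j) (entries π))) ≡ all unimodalᵇ (segments λ' (entries σ))
    tail-unimodal-equiv =
      trans (cong (all unimodalᵇ ∘ segments λ') (trans (drop-entries-++ block _) (entries-map-↑ʳ (suc j) σ)))
            (all-unimodalᵇ-segments-map-+ (suc j) λ' (entries σ))
    involution-equiv : involutionᵇ π ≡ involutionᵇ σ
    involution-equiv = ⇔→≡ (⇔.trans (involutionᵇ-reflects π) (⇔.trans π-involution⇔σ-involution (⇔.sym (involutionᵇ-reflects σ))))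
      where
      π-involution⇔σ-involution : IsInvolution π ⇔ IsInvolution σ
      π-involution⇔σ-involution = mk⇔ (proj₂ ∘ ⊕-involution⁻ descending σ) (⊕-involution descending σ descending-involution)

lemma4p3 : (λ₁ : ℕ) (λ' : List ℕ) → 0 < λ₁ → All (0 <_) λ' →
           countD1 λ₁ λ' ≡ countI λ'
lemma4p3 zero    λ' () _
lemma4p3 (suc j) λ' _  _ = begin
  countD1 (suc j) λ'                                   ≡⟨ count-allVecs-++ (suc j) M block D1 block-forced ⟩
  count (D1 ∘ (block Vec.++_)) (allVecs (suc j + M) M) ≡⟨ count-allVecs-↑ʳ (suc j) M M _ tail-avoids-block ⟩
  count (D1 ∘ (descending ⊕_)) (allVecs M M)           ≡⟨ count-cong D1-descending-⊕ (allVecs M M) ⟩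
  countI λ'                                            ∎
  where
  open FirstBlockDescending j λ'
  open ≡-Reasoning
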